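{- Let $(\pi,V)\in\mathrm{VHC}(\mathrm{Av}_n(312))$, let $\mathfrak R_0,\ldots,\mathfrak R_\ell$ be the left-to-right maxima of $\pi$ listed from right to left, and let $P$ be the first component of $\widehat\Lambda_n(\pi,V)$. Suppose the valid hook configuration contains a hook with southwest endpoint $A$ and northeast endpoint $B=\mathfrak R_{i-1}$ for some $i\in[\ell]$. Then $\mathrm{lng}_i(P)$ equals the horizontal distance between $A$ and $B$ (the difference of their first coordinates).
   Context: For $\pi\in S_n$ with plot $\{(i,\pi_i)\}$: $(i,\pi_i)$ is a descent top if $i<n$, $\pi_i>\pi_{i+1}$. A hook from $(i,\pi_i)$ to $(j,\pi_j)$ ($i<j$, $\pi_i<\pi_j$) is the vertical segment from $(i,\pi_i)$ to $(i,\pi_j)$ then horizontal to $(j,\pi_j)$ (southwest/northeast endpoints). A valid hook configuration (VHC) is a set of hooks with (i) southwest endpoints exactly the descent tops; (ii) for each hook from $(i,\pi_i)$ to $(j,\pi_j)$ no $k$ with $i<k<j$, $\pi_k>\pi_j$; (iii) hooks meeting only at endpoints; written $(\pi,V)$ with $V$ its set of northeast endpoints. $\mathrm{Av}_n(312)$: permutations with no $a<b<c$, $\pi_b<\pi_c<\pi_a$. A left-to-right maximum is a point with no strictly higher point to its left; if $\pi$ has a VHC then $\pi_n=n$, so $\mathfrak R_0=(n,n)$. Set $\mathfrak R_{\ell+1}=(0,0)$. For $i\in[\ell]$, $\gamma_i$ is the number of points strictly right of $\mathfrak R_i$ and strictly left of $\mathfrak R_{i-1}$, $\gamma'_i$ the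 number of points strictly above $\mathfrak R_{i+1}$ and strictly below $\mathfrak R_i$, and $X_i=U$ if $\mathfrak R_{i-1}\in V$, $X_i=E$ otherwise; $\widehat\Lambda_n(\pi,V)=(X_1D^{\gamma_1}\cdots X_\ell D^{\gamma_\ell},X_1D^{\gamma'_1}\cdots X_\ell D^{\gamma'_\ell})$. For a Motzkin path $P=X_1D^{\gamma_1}\cdots X_\ell D^{\gamma_\ell}$ (a Motzkin path being a word in $\{U,D,E\}$ with equally many $U$'s and $D$'s and every prefix having at least as many $U$'s as $D$'s), $\mathrm{lng}_i(P)$ is the length of the shortest consecutive substring starting at $X_i$ that is a Motzkin path. -}

module Defs where

open import Data.Nat as ℕ using (ℕ; zero; suc; _∸_; _≤_; _<_; _<?_)
open import Data.Fin as Fin using (Fin; toℕ; inject₁)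
open import Data.Fin.Properties using (any?)
open import Data.Fin.Permutation using (Permutation′; _⟨$⟩ʳ_)
open import Data.Integer using (+_)
open import Data.Rational as ℚ using (ℚ)
open import Data.List using (List; []; _∷_; length; take; drop; replicate; concat; map; filter; allFin)
open import Data.Maybe using (Maybe; just)
open import Data.Nat.ListAction using (sum)
open import Data.Product using (Σ; ∃; ∃-syntax; _×_; _,_)
open import Relation.Nullary using (¬_; Dec; yes; no)
open import Relation.Nullary.Decidable using (_×-dec_)
open import Relation.Binary.PropositionalEquality using (_≡_; _≢_)
open import Data.Sum using (_⊎_)
open import Function.Bundles using (_⇔_)

-- Position i : Fin n is plotted at the point
-- (xc i , yc π i) = (toℕ i + 1 , toℕ (π i) + 1), i.e. 1-based as in the
-- paper.

xc : ∀ {n} → Fin n → ℕ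
xc i = suc (toℕ i)

yc : ∀ {n} → Permutation′ n → Fin n → ℕ
yc π i = suc (toℕ (π ⟨$⟩ʳ i))

Avoids312 : ∀ {n} → Permutation′ n → Set
Avoids312 {n} π =
  ¬ (Σ (Fin n) λ a → Σ (Fin n) λ b → Σ (Fin n) λ c →
       xc a < xc b × xc b < xc c × yc π b < yc π c × yc π c < yc π a)

DescentTop : ∀ {n} → Permutation′ n → Fin n → Set
DescentTop {n} π i = Σ (Fin n) λ k → xc k ≡ suc (xc i) × yc π k < yc π i

-- Points of the real plane; rational points suffice since all segments
-- have integer endpoints.
Point : Set
Point = ℚ × ℚ

ι : ℕ → ℚ
ι k = (+ k) ℚ./ 1

OnHook : ∀ {n} → Permutation′ n → Fin n → Fin n → Point → Set
OnHook π a b (p , q) =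
    (p ≡ ι (xc a) × ι (yc π a) ℚ.≤ q × q ℚ.≤ ι (yc π b))
  ⊎ (q ≡ ι (yc π b) × ι (xc a) ℚ.≤ p × p ℚ.≤ ι (xc b))

IsEndpoint : ∀ {n} → Permutation′ n → Fin n → Fin n → Point → Set
IsEndpoint π a b pt =
  (pt ≡ (ι (xc a) , ι (yc π a))) ⊎ (pt ≡ (ι (xc b) , ι (yc π b)))

-- A set of hooks is represented by h : Fin n → Maybe (Fin n), where
-- h a ≡ just b  means the hook from (a,π_a) to (b,π_b) belongs to the set.
-- (Two distinct hooks with the same southwest endpoint would overlap along
-- their vertical segments, so this loses no generality.)
record IsVHC {n} (π : Permutation′ n) (h : Fin n → Maybe (Fin n)) : Set where
  field
    sw-descent : ∀ a → (∃[ b ] h a ≡ just b) ⇔ DescentTop π a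
    hook-x : ∀ a b → h a ≡ just b → xc a < xc b
    hook-y : ∀ a b → h a ≡ just b → yc π a < yc π b
    hook-valid : ∀ a b → h a ≡ just b →
      ∀ k → xc a < xc k → xc k < xc b → ¬ (yc π b < yc π k)
    meet-endpoints : ∀ a b a′ b′ → h a ≡ just b → h a′ ≡ just b′ → a ≢ a′ →
      ∀ pt → OnHook π a b pt → OnHook π a′ b′ pt →
      IsEndpoint π a b pt × IsEndpoint π a′ b′ pt

InV : ∀ {n} → (Fin n → Maybe (Fin n)) → Fin n → Set
InV {n} h b = ∃[ a ] h a ≡ just b

InV? : ∀ {n} (h : Fin n → Maybe (Fin n)) (b : Fin n) → Dec (InV h b)
InV? h b = any? (λ a → Data.Maybe.Properties.≡-dec Data.Fin._≟_ (h a) (just b))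
  where import Data.Maybe.Properties
        import Data.Fin

LRMax : ∀ {n} → Permutation′ n → Fin n → Set
LRMax {n} π k = ∀ (m : Fin n) → xc m < xc k → ¬ (yc π k < yc π m)

data Step : Set where
  U D E : Step

countU countD : List Step → ℕ
countU [] = 0
countU (U ∷ w) = suc (countU w)
countU (_ ∷ w) = countU w
countD [] = 0
countD (D ∷ w) = suc (countD w)
countD (_ ∷ w) = countD w

Motzkin : List Step → Set
Motzkin w = countU w ≡ countD w × (∀ k → countD (take k w) ≤ countU (take k w))

IsShortestMotzkinFrom : List Step → ℕ → ℕ → Set
IsShortestMotzkinFrom P s m =
  1 ≤ m × s ℕ.+ m ≤ length P × Motzkin (take m (drop s P)) ×
  (∀ m′ → 1 ≤ m′ → m′ < m → ¬ Motzkin (take m′ (drop s P)))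

-- The first component P of Λ̂_n(π,V), given the left-to-right maxima
-- R 0, …, R ℓ listed from right to left.  For j : Fin ℓ, the index i = j+1
-- of the paper; R_{i-1} = R (inject₁ j), R_i = R (Fin.suc j).

γ : ∀ {n ℓ} → (Fin (suc ℓ) → Fin n) → Fin ℓ → ℕ
γ {n} R j = length (filter (λ k → (xc (R (Fin.suc j)) <? xc k) ×-dec (xc k <? xc (R (inject₁ j))))
                           (allFin n))

Xstep : ∀ {n ℓ} → (Fin n → Maybe (Fin n)) → (Fin (suc ℓ) → Fin n) → Fin ℓ → Step
Xstep h R j with InV? h (R (inject₁ j))
... | yes _ = U
... | no  _ = E

block : ∀ {n ℓ} → (Fin n → Maybe (Fin n)) → (Fin (suc ℓ) → Fin n) → Fin ℓ → List Step
block h R j = Xstep h R j ∷ replicate (γ R j) D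

pathP : ∀ {n ℓ} → (Fin n → Maybe (Fin n)) → (Fin (suc ℓ) → Fin n) → List Step
pathP {ℓ = ℓ} h R = concat (map (block h R) (allFin ℓ))

posX : ∀ {n ℓ} → (Fin n → Maybe (Fin n)) → (Fin (suc ℓ) → Fin n) → Fin ℓ → ℕ
posX {ℓ = ℓ} h R j = sum (map (λ j′ → length (block h R j′)) (take (toℕ j) (allFin ℓ)))

LngIs : ∀ {n ℓ} → (Fin n → Maybe (Fin n)) → (Fin (suc ℓ) → Fin n) → Fin ℓ → ℕ → Set
LngIs h R j m = IsShortestMotzkinFrom (pathP h R) (posX h R j) m

module Submission where

-- Read from right to left, P has one letter per position x ≥ 1 of π: D when x − 1 is a descent top
-- (by 312-avoidance these are exactly the positions that are not left-to-right maxima), U when x is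
-- a northeast endpoint, and E otherwise.  Let the hook run from position A to position B.  Reading
-- leftwards from B, the height after k letters is the number of hooks that start in [A, B − k) and
-- end to the right of B − k: moving from z to z − 1 lets in the hook ending at z (it starts in
-- [A, z) because hooks do not cross) and lets out the hook starting at z − 1.  This count vanishes
-- for k = 0 (hooks nested under A → B end by B) and for k = B − A, and is positive in between (the
-- hook A → B itself is counted), so the shortest Motzkin path starting at X_i has length B − A.

open import Defs
open import Data.Bool using (true; false)
open import Data.Empty using (⊥; ⊥-elim)
open import Data.Fin as Fin using (Fin; toℕ; fromℕ<; fromℕ; inject₁)
open import Data.Fin.Permutation using (Permutation′; _⟨$⟩ˡ_; inverseˡ)
open import Data.Fin.Properties using (toℕ-injective; toℕ<n; toℕ-fromℕ<; fromℕ<-toℕ; toℕ-fromℕ; toℕ-inject₁)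
import Data.Integer as ℤ
import Data.Integer.Properties as ℤₚ
open import Data.List using (List; []; _∷_; [_]; _++_; length; take; drop; replicate; map; filter; concat; allFin; tabulate)
import Data.List.Properties as Listₚ
open import Data.Maybe as Maybe using (Maybe; just; nothing)
open import Data.Maybe.Properties using (just-injective)
open import Data.Nat as ℕ using (ℕ; zero; suc; _+_; _∸_; _⊓_; _≤_; _<_; _<?_; z≤n; s≤s)
import Data.Nat.Coprimality as Coprimality
open import Data.Nat.ListAction using (sum)
import Data.Nat.Properties as ℕₚ
open import Algebra.Properties.CommutativeSemigroup ℕₚ.+-commutativeSemigroup using ()
  renaming (interchange to +-interchange; xy∙z≈y∙xz to +-exchange-right; x∙yz≈y∙xz to +-exchange-left)
open import Data.Nat.Tactic.RingSolver using (solve-∀)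
open import Data.Product using (Σ; ∃-syntax; _×_; _,_; proj₁; proj₂)
open import Data.Rational as ℚ using (mkℚ)
import Data.Rational.Properties as ℚₚ
open import Data.Sum using (inj₁; inj₂)
open import Function using (_∘_)
open import Function.Bundles using (Equivalence)
open import Relation.Binary using (tri<; tri≈; tri>)
open import Relation.Binary.PropositionalEquality hiding ([_])
open import Relation.Nullary using (¬_; Dec; yes; no; does; contradiction)
open import Relation.Nullary.Decidable using (_×-dec_)
open import Relation.Unary using (Pred; Decidable)

m∸n+n∸o≡m∸o : ∀ {m n o} → o ≤ n → n ≤ m → (m ∸ n) + (n ∸ o) ≡ m ∸ o
m∸n+n∸o≡m∸o {m} {n} {o} o≤n n≤m = trans (sym (ℕₚ.+-∸-assoc (m ∸ n) o≤n)) (cong (_∸ o) (ℕₚ.m∸n+n≡m n≤m))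

m<o∸n⇒n+m<o : ∀ {m n o} → n ≤ o → m < o ∸ n → n + m < o
m<o∸n⇒n+m<o {m} {n} {o} n≤o m<o∸n = subst (_≤ o) (cong suc (ℕₚ.+-comm m n)) (ℕₚ.m≤o∸n⇒m+n≤o (suc m) n≤o m<o∸n)

-- Sums of indicators over intervals

indicator : ∀ {p} {P : Set p} → Dec P → ℕ
indicator (yes _) = 1
indicator (no _) = 0

indicator-yes : ∀ {p} {P : Set p} (d : Dec P) → P → indicator d ≡ 1
indicator-yes (yes _) _ = refl
indicator-yes (no ¬p) p = contradiction p ¬p

indicator-no : ∀ {p} {P : Set p} (d : Dec P) → ¬ P → indicator d ≡ 0
indicator-no (yes p) ¬p = contradiction p ¬p
indicator-no (no _) _ = refl

sumFrom : (ℕ → ℕ) → ℕ → ℕ → ℕ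
sumFrom f lo zero = 0
sumFrom f lo (suc L) = sumFrom f lo L + f (lo + L)

module _ (f : ℕ → ℕ) (lo : ℕ) where

  sumFrom-cong : ∀ {g} L → (∀ i → i < L → f (lo + i) ≡ g (lo + i)) → sumFrom f lo L ≡ sumFrom g lo L
  sumFrom-cong zero _ = refl
  sumFrom-cong (suc L) f≗g = cong₂ _+_ (sumFrom-cong L (λ i i<L → f≗g i (ℕₚ.m<n⇒m<1+n i<L))) (f≗g L ℕₚ.≤-refl)

  sumFrom-zero : ∀ L → (∀ i → i < L → f (lo + i) ≡ 0) → sumFrom f lo L ≡ 0
  sumFrom-zero zero _ = refl
  sumFrom-zero (suc L) f≡0 = cong₂ _+_ (sumFrom-zero L (λ i i<L → f≡0 i (ℕₚ.m<n⇒m<1+n i<L))) (f≡0 L ℕₚ.≤-refl)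

  sumFrom-one : ∀ L → (∀ i → i < L → f (lo + i) ≡ 1) → sumFrom f lo L ≡ L
  sumFrom-one zero _ = refl
  sumFrom-one (suc L) f≡1 = trans (cong₂ _+_ (sumFrom-one L (λ i i<L → f≡1 i (ℕₚ.m<n⇒m<1+n i<L))) (f≡1 L ℕₚ.≤-refl))
                                  (ℕₚ.+-comm L 1)

  sumFrom-single : ∀ L i₀ → i₀ < L → f (lo + i₀) ≡ 1 → (∀ i → i < L → i ≢ i₀ → f (lo + i) ≡ 0) →
                   sumFrom f lo L ≡ 1
  sumFrom-single (suc L) i₀ i₀≤L f≡1 f≡0 with i₀ ℕ.≟ L
  ... | yes refl = cong₂ _+_ (sumFrom-zero L (λ i i<L → f≡0 i (ℕₚ.m<n⇒m<1+n i<L) (ℕₚ.<⇒≢ i<L))) f≡1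
  ... | no i₀≢L = cong₂ _+_
    (sumFrom-single L i₀ (ℕₚ.≤∧≢⇒< (ℕₚ.≤-pred i₀≤L) i₀≢L) f≡1 (λ i i<L → f≡0 i (ℕₚ.m<n⇒m<1+n i<L)))
    (f≡0 L ℕₚ.≤-refl (i₀≢L ∘ sym))

  term≤sumFrom : ∀ L i → i < L → f (lo + i) ≤ sumFrom f lo L
  term≤sumFrom (suc L) i i≤L with i ℕ.≟ L
  ... | yes refl = ℕₚ.m≤n+m _ _
  ... | no i≢L = ℕₚ.≤-trans (term≤sumFrom L i (ℕₚ.≤∧≢⇒< (ℕₚ.≤-pred i≤L) i≢L)) (ℕₚ.m≤m+n _ _)

  sumFrom-++ : ∀ L M → sumFrom f lo (L + M) ≡ sumFrom f lo L + sumFrom f (lo + L) M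
  sumFrom-++ L zero = trans (cong (sumFrom f lo) (ℕₚ.+-identityʳ L)) (sym (ℕₚ.+-identityʳ _))
  sumFrom-++ L (suc M) = begin
    sumFrom f lo (L + suc M)                          ≡⟨ cong (sumFrom f lo) (ℕₚ.+-suc L M) ⟩
    sumFrom f lo (L + M) + f (lo + (L + M))           ≡⟨ cong₂ _+_ (sumFrom-++ L M) (cong f (sym (ℕₚ.+-assoc lo L M))) ⟩
    (sumFrom f lo L + sumFrom f (lo + L) M) + f (lo + L + M) ≡⟨ ℕₚ.+-assoc (sumFrom f lo L) _ _ ⟩
    sumFrom f lo L + sumFrom f (lo + L) (suc M)       ∎
    where open ≡-Reasoning

  sumFrom-snoc : ∀ z → lo ≤ z → sumFrom f lo (suc z ∸ lo) ≡ sumFrom f lo (z ∸ lo) + f z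
  sumFrom-snoc z lo≤z rewrite ℕₚ.+-∸-assoc 1 lo≤z = cong (sumFrom f lo (z ∸ lo) +_) (cong f (ℕₚ.m+[n∸m]≡n lo≤z))

sumFrom-+ : ∀ f g lo L → sumFrom (λ x → f x + g x) lo L ≡ sumFrom f lo L + sumFrom g lo L
sumFrom-+ f g lo zero = refl
sumFrom-+ f g lo (suc L) rewrite sumFrom-+ f g lo L = +-interchange (sumFrom f lo L) (sumFrom g lo L) (f (lo + L)) (g (lo + L))

sumFrom-shift : ∀ f lo L → sumFrom f (suc lo) L ≡ sumFrom (f ∘ suc) lo L
sumFrom-shift f lo zero = refl
sumFrom-shift f lo (suc L) = cong (_+ f (suc (lo + L))) (sumFrom-shift f lo L)

sumFrom-∷ : ∀ f lo L → sumFrom f lo (suc L) ≡ f lo + sumFrom f (suc lo) L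
sumFrom-∷ f lo L =
  trans (sumFrom-++ f lo 1 L) (cong₂ _+_ (cong f (ℕₚ.+-identityʳ lo)) (cong (λ x → sumFrom f x L) (ℕₚ.+-comm lo 1)))

length-filter-map : ∀ {A B : Set} {q} {Q : Pred B q} (Q? : Decidable Q) (f : A → B) xs →
  length (filter Q? (map f xs)) ≡ length (filter (Q? ∘ f) xs)
length-filter-map Q? f [] = refl
length-filter-map Q? f (x ∷ xs) with does (Q? (f x))
... | true = cong suc (length-filter-map Q? f xs)
... | false = length-filter-map Q? f xs

length-filter-allFin : ∀ {q} {Q : Pred ℕ q} (Q? : Decidable Q) n →
  length (filter (Q? ∘ toℕ) (allFin n)) ≡ sumFrom (indicator ∘ Q?) 0 n
length-filter-allFin Q? zero = refl
length-filter-allFin Q? (suc n) = trans head (sym (sumFrom-∷ (indicator ∘ Q?) 0 n))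
  where
  tail : length (filter (Q? ∘ toℕ) (tabulate {n = n} Fin.suc)) ≡ sumFrom (indicator ∘ Q?) 1 n
  tail = begin
    length (filter (Q? ∘ toℕ) (tabulate {n = n} Fin.suc))
      ≡⟨ cong (length ∘ filter (Q? ∘ toℕ)) (Listₚ.map-tabulate {n = n} (λ k → k) Fin.suc) ⟨
    length (filter (Q? ∘ toℕ) (map Fin.suc (allFin n))) ≡⟨ length-filter-map (Q? ∘ toℕ) Fin.suc (allFin n) ⟩
    length (filter (Q? ∘ suc ∘ toℕ) (allFin n))    ≡⟨ length-filter-allFin (Q? ∘ suc) n ⟩
    sumFrom (indicator ∘ Q? ∘ suc) 0 n             ≡⟨ sumFrom-shift (indicator ∘ Q?) 0 n ⟨
    sumFrom (indicator ∘ Q?) 1 n                   ∎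
    where open ≡-Reasoning
  head : length (filter (Q? ∘ toℕ) (allFin (suc n))) ≡ indicator (Q? 0) + sumFrom (indicator ∘ Q?) 1 n
  head with Q? 0
  ... | yes _ = cong suc tail
  ... | no _ = tail

sumFrom-interval : ∀ {q} {Q : Pred ℕ q} (Q? : Decidable Q) {lo hi} N →
  (∀ x → Q x → lo < x × x < hi) → (∀ x → lo < x → x < hi → Q x) → lo < hi → hi ≤ N →
  sumFrom (indicator ∘ Q?) 0 N ≡ hi ∸ suc lo
sumFrom-interval Q? {lo} {hi} N Q⇒ ⇒Q lo<hi hi≤N = begin
  sumFrom f 0 N                                       ≡⟨ cong (sumFrom f 0) (ℕₚ.m+[n∸m]≡n hi≤N) ⟨
  sumFrom f 0 (hi + (N ∸ hi))                         ≡⟨ sumFrom-++ f 0 hi (N ∸ hi) ⟩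
  sumFrom f 0 hi + sumFrom f hi (N ∸ hi)              ≡⟨ cong (sumFrom f 0 hi +_) (sumFrom-zero f hi (N ∸ hi) above) ⟩
  sumFrom f 0 hi + 0                                  ≡⟨ ℕₚ.+-identityʳ _ ⟩
  sumFrom f 0 hi                                      ≡⟨ cong (sumFrom f 0) (ℕₚ.m+[n∸m]≡n lo<hi) ⟨
  sumFrom f 0 (suc lo + (hi ∸ suc lo))                ≡⟨ sumFrom-++ f 0 (suc lo) (hi ∸ suc lo) ⟩
  sumFrom f 0 (suc lo) + sumFrom f (suc lo) (hi ∸ suc lo)
    ≡⟨ cong₂ _+_ (sumFrom-zero f 0 (suc lo) below) (sumFrom-one f (suc lo) (hi ∸ suc lo) inside) ⟩
  hi ∸ suc lo                                         ∎
  where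
  open ≡-Reasoning
  f = indicator ∘ Q?
  below : ∀ i → i < suc lo → f (0 + i) ≡ 0
  below i i≤lo = indicator-no (Q? i) λ Qi → ℕₚ.<⇒≱ (proj₁ (Q⇒ i Qi)) (ℕₚ.≤-pred i≤lo)
  above : ∀ i → i < N ∸ hi → f (hi + i) ≡ 0
  above i _ = indicator-no (Q? (hi + i)) λ Qx → ℕₚ.<⇒≱ (proj₂ (Q⇒ (hi + i) Qx)) (ℕₚ.m≤m+n hi i)
  inside : ∀ i → i < hi ∸ suc lo → f (suc lo + i) ≡ 1
  inside i i<gap = indicator-yes (Q? (suc lo + i)) (⇒Q (suc lo + i) (s≤s (ℕₚ.m≤m+n lo i))
    (subst (suc lo + i <_) (ℕₚ.m+[n∸m]≡n lo<hi) (ℕₚ.+-monoʳ-< (suc lo) i<gap)))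

-- Descending lists of positions and Motzkin prefixes

countdown : ℕ → ℕ → List ℕ
countdown x zero = []
countdown x (suc k) = x ∷ countdown (x ∸ 1) k

countdown-+ : ∀ x k l → countdown x (k + l) ≡ countdown x k ++ countdown (x ∸ k) l
countdown-+ x zero l = refl
countdown-+ x (suc k) l = cong (x ∷_) (trans (countdown-+ (x ∸ 1) k l)
  (cong (λ y → countdown (x ∸ 1) k ++ countdown y l) (ℕₚ.∸-+-assoc x 1 k)))

take-countdown : ∀ x k l → take k (countdown x l) ≡ countdown x (k ⊓ l)
take-countdown x zero l = refl
take-countdown x (suc k) zero = refl
take-countdown x (suc k) (suc l) = cong (x ∷_) (take-countdown (x ∸ 1) k l)

drop-countdown : ∀ x k l → drop k (countdown x l) ≡ countdown (x ∸ k) (l ∸ k)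
drop-countdown x zero l = refl
drop-countdown x (suc k) zero = refl
drop-countdown x (suc k) (suc l) = trans (drop-countdown (x ∸ 1) k l) (cong (λ y → countdown y (l ∸ k)) (ℕₚ.∸-+-assoc x 1 k))

take-drop-countdown : ∀ {x y k} → y ≤ x → k ≤ y → take k (drop (x ∸ y) (countdown x x)) ≡ countdown y k
take-drop-countdown {x} {y} {k} y≤x k≤y = begin
  take k (drop (x ∸ y) (countdown x x))             ≡⟨ cong (take k) (drop-countdown x (x ∸ y) x) ⟩
  take k (countdown (x ∸ (x ∸ y)) (x ∸ (x ∸ y)))    ≡⟨ cong (λ z → take k (countdown z z)) (ℕₚ.m∸[m∸n]≡n y≤x) ⟩
  take k (countdown y y)                            ≡⟨ take-countdown y k y ⟩
  countdown y (k ⊓ y)                               ≡⟨ cong (countdown y) (ℕₚ.m≤n⇒m⊓n≡m k≤y) ⟩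
  countdown y k                                     ∎
  where open ≡-Reasoning

length-countdown : ∀ x l → length (countdown x l) ≡ l
length-countdown x zero = refl
length-countdown x (suc l) = cong suc (length-countdown (x ∸ 1) l)

map-countdown-constant : ∀ {A : Set} (f : ℕ → A) a x l → (∀ i → i < l → f (x ∸ i) ≡ a) → map f (countdown x l) ≡ replicate l a
map-countdown-constant f a x zero _ = refl
map-countdown-constant f a x (suc l) f≡a = cong₂ _∷_ (f≡a 0 (s≤s z≤n))
  (map-countdown-constant f a (x ∸ 1) l (λ i i<l → trans (cong f (ℕₚ.∸-+-assoc x 1 i)) (f≡a (suc i) (s≤s i<l))))

countU-∷ : ∀ s w → countU (s ∷ w) ≡ countU [ s ] + countU w
countU-∷ U w = refl
countU-∷ D w = refl
countU-∷ E w = refl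

countD-∷ : ∀ s w → countD (s ∷ w) ≡ countD [ s ] + countD w
countD-∷ U w = refl
countD-∷ D w = refl
countD-∷ E w = refl

shortest-Motzkin-prefix : (v : List Step) (m : ℕ) (H : ℕ → ℕ) →
  (∀ k → k ≤ m → countU (take k v) ≡ countD (take k v) + H k) →
  H m ≡ 0 → (∀ k → 1 ≤ k → k < m → 1 ≤ H k) →
  Motzkin (take m v) × (∀ k → 1 ≤ k → k < m → ¬ Motzkin (take k v))
shortest-Motzkin-prefix v m H height Hm≡0 H>0 = (balanced , prefixes) , shorter
  where
  balanced : countU (take m v) ≡ countD (take m v)
  balanced = trans (height m ℕₚ.≤-refl) (trans (cong (countD (take m v) +_) Hm≡0) (ℕₚ.+-identityʳ _))
  prefixes : ∀ k → countD (take k (take m v)) ≤ countU (take k (take m v))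
  prefixes k rewrite Listₚ.take-take k m v =
    subst (countD (take (k ⊓ m) v) ≤_) (sym (height (k ⊓ m) (ℕₚ.m⊓n≤n k m))) (ℕₚ.m≤m+n _ _)
  shorter : ∀ k → 1 ≤ k → k < m → ¬ Motzkin (take k v)
  shorter k 1≤k k<m (balancedₖ , _) =
    ℕₚ.<-irrefl (trans (sym balancedₖ) (height k (ℕₚ.<⇒≤ k<m))) (ℕₚ.m<m+n (countD (take k v)) (H>0 k 1≤k k<m))

countdown-balance : (letter : ℕ → Step) (C : ℕ → ℕ) (lo hi : ℕ) →
  (∀ z → lo ≤ z → suc z ≤ hi → countU [ letter (suc z) ] + C (suc z) ≡ countD [ letter (suc z) ] + C z) →
  ∀ k z → k + lo ≤ z → z ≤ hi →
  countU (map letter (countdown z k)) + C z ≡ countD (map letter (countdown z k)) + C (z ∸ k)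
countdown-balance letter C lo hi step zero z _ _ = refl
countdown-balance letter C lo hi step (suc k) (suc z) (s≤s k+lo≤z) z<hi = begin
  countU (l ∷ rest) + C (suc z)             ≡⟨ cong (_+ C (suc z)) (countU-∷ l rest) ⟩
  (countU [ l ] + countU rest) + C (suc z)  ≡⟨ +-exchange-right (countU [ l ]) (countU rest) (C (suc z)) ⟩
  countU rest + (countU [ l ] + C (suc z))  ≡⟨ cong (countU rest +_) (step z (ℕₚ.m+n≤o⇒n≤o k k+lo≤z) z<hi) ⟩
  countU rest + (countD [ l ] + C z)        ≡⟨ +-exchange-left (countU rest) (countD [ l ]) (C z) ⟩
  countD [ l ] + (countU rest + C z)
    ≡⟨ cong (countD [ l ] +_) (countdown-balance letter C lo hi step k z k+lo≤z (ℕₚ.<⇒≤ z<hi)) ⟩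
  countD [ l ] + (countD rest + C (z ∸ k))  ≡⟨ ℕₚ.+-assoc (countD [ l ]) (countD rest) _ ⟨
  (countD [ l ] + countD rest) + C (z ∸ k)  ≡⟨ cong (_+ C (z ∸ k)) (countD-∷ l rest) ⟨
  countD (l ∷ rest) + C (z ∸ k)             ∎
  where
  open ≡-Reasoning
  l = letter (suc z)
  rest = map letter (countdown z k)

-- Telescoping the gaps of an antitone sequence

map-allFin-suc : ∀ {A : Set} ℓ (f : Fin (suc ℓ) → A) → map f (allFin (suc ℓ)) ≡ f Fin.zero ∷ map (f ∘ Fin.suc) (allFin ℓ)
map-allFin-suc ℓ f = cong (f Fin.zero ∷_) (trans (Listₚ.map-tabulate Fin.suc f) (sym (Listₚ.map-tabulate (λ t → t) (f ∘ Fin.suc))))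

Antitone : ∀ {ℓ} → (Fin (suc ℓ) → ℕ) → Set
Antitone c = ∀ j j′ → toℕ j ≤ toℕ j′ → c j′ ≤ c j

Antitone-suc : ∀ {ℓ} {c : Fin (suc (suc ℓ)) → ℕ} → Antitone c → Antitone (c ∘ Fin.suc)
Antitone-suc antitone j j′ j≤j′ = antitone (Fin.suc j) (Fin.suc j′) (s≤s j≤j′)

gap : ∀ {ℓ} → (Fin (suc ℓ) → ℕ) → Fin ℓ → ℕ
gap c t = c (inject₁ t) ∸ c (Fin.suc t)

concat-countdown-gaps : ∀ ℓ (c : Fin (suc ℓ) → ℕ) → Antitone c →
  concat (map (λ t → countdown (c (inject₁ t)) (gap c t)) (allFin ℓ)) ≡ countdown (c Fin.zero) (c Fin.zero ∸ c (fromℕ ℓ))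
concat-countdown-gaps zero c _ = cong (countdown (c Fin.zero)) (sym (ℕₚ.n∸n≡0 (c Fin.zero)))
concat-countdown-gaps (suc ℓ) c antitone = begin
  concat (map piece (allFin (suc ℓ)))                      ≡⟨ cong concat (map-allFin-suc ℓ piece) ⟩
  countdown c₀ (c₀ ∸ c₁) ++ concat (map (piece ∘ Fin.suc) (allFin ℓ))
    ≡⟨ cong (countdown c₀ (c₀ ∸ c₁) ++_) (concat-countdown-gaps ℓ (c ∘ Fin.suc) (Antitone-suc antitone)) ⟩
  countdown c₀ (c₀ ∸ c₁) ++ countdown c₁ (c₁ ∸ cₗ)
    ≡⟨ cong (λ x → countdown c₀ (c₀ ∸ c₁) ++ countdown x (c₁ ∸ cₗ)) (ℕₚ.m∸[m∸n]≡n c₁≤c₀) ⟨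
  countdown c₀ (c₀ ∸ c₁) ++ countdown (c₀ ∸ (c₀ ∸ c₁)) (c₁ ∸ cₗ) ≡⟨ countdown-+ c₀ (c₀ ∸ c₁) (c₁ ∸ cₗ) ⟨
  countdown c₀ ((c₀ ∸ c₁) + (c₁ ∸ cₗ))                         ≡⟨ cong (countdown c₀) (m∸n+n∸o≡m∸o cₗ≤c₁ c₁≤c₀) ⟩
  countdown c₀ (c₀ ∸ cₗ)                                       ∎
  where
  open ≡-Reasoning
  piece : Fin (suc ℓ) → List ℕ
  piece t = countdown (c (inject₁ t)) (gap c t)
  c₀ = c Fin.zero
  c₁ = c (Fin.suc Fin.zero)
  cₗ = c (fromℕ (suc ℓ))
  c₁≤c₀ : c₁ ≤ c₀
  c₁≤c₀ = antitone Fin.zero (Fin.suc Fin.zero) z≤n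
  cₗ≤c₁ : cₗ ≤ c₁
  cₗ≤c₁ = antitone (Fin.suc Fin.zero) (fromℕ (suc ℓ)) (subst (1 ≤_) (sym (toℕ-fromℕ (suc ℓ))) (s≤s z≤n))

sum-gaps : ∀ ℓ (c : Fin (suc ℓ) → ℕ) → Antitone c →
  ∀ j → sum (take (toℕ j) (map (gap c) (allFin ℓ))) ≡ c Fin.zero ∸ c (inject₁ j)
sum-gaps (suc ℓ) c _ Fin.zero = sym (ℕₚ.n∸n≡0 (c Fin.zero))
sum-gaps (suc ℓ) c antitone (Fin.suc j) = begin
  sum (take (suc (toℕ j)) (map (gap c) (allFin (suc ℓ))))  ≡⟨ cong (sum ∘ take (suc (toℕ j))) (map-allFin-suc ℓ (gap c)) ⟩
  gap c Fin.zero + sum (take (toℕ j) (map (gap c ∘ Fin.suc) (allFin ℓ)))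
    ≡⟨ cong (gap c Fin.zero +_) (sum-gaps ℓ (c ∘ Fin.suc) (Antitone-suc antitone) j) ⟩
  (c₀ ∸ c₁) + (c₁ ∸ cⱼ)                                    ≡⟨ m∸n+n∸o≡m∸o cⱼ≤c₁ c₁≤c₀ ⟩
  c₀ ∸ cⱼ                                                  ∎
  where
  open ≡-Reasoning
  c₀ = c Fin.zero
  c₁ = c (Fin.suc Fin.zero)
  cⱼ = c (Fin.suc (inject₁ j))
  c₁≤c₀ : c₁ ≤ c₀
  c₁≤c₀ = antitone Fin.zero (Fin.suc Fin.zero) z≤n
  cⱼ≤c₁ : cⱼ ≤ c₁
  cⱼ≤c₁ = antitone (Fin.suc Fin.zero) (Fin.suc (inject₁ j)) (s≤s z≤n)

-- Positions, left-to-right maxima and descent tops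

module _ {n : ℕ} where

  extend : ∀ {A : Set} → A → (Fin n → A) → ℕ → A
  extend d f x with x <? n
  ... | yes x<n = f (fromℕ< x<n)
  ... | no _ = d

  extend-toℕ : ∀ {A : Set} (d : A) (f : Fin n → A) i → extend d f (toℕ i) ≡ f i
  extend-toℕ d f i with toℕ i <? n
  ... | yes i<n = cong f (fromℕ<-toℕ i i<n)
  ... | no i≮n = contradiction (toℕ<n i) i≮n

  fromFin : ∀ {p} (P : ℕ → Set p) → (∀ (i : Fin n) → P (toℕ i)) → ∀ x → x < n → P x
  fromFin P P-toℕ x x<n = subst P (toℕ-fromℕ< x<n) (P-toℕ (fromℕ< x<n))

predecessor : ∀ {n} (i : Fin n) → 0 < toℕ i → Σ (Fin n) λ i′ → toℕ i ≡ suc (toℕ i′)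
predecessor (Fin.suc j) _ = inject₁ j , cong suc (sym (toℕ-inject₁ j))

module _ {n} (π : Permutation′ n) where

  xc-injective : ∀ {i j : Fin n} → xc i ≡ xc j → i ≡ j
  xc-injective = toℕ-injective ∘ ℕₚ.suc-injective

  yc-injective : ∀ {i j : Fin n} → yc π i ≡ yc π j → i ≡ j
  yc-injective {i} {j} eq =
    trans (sym (inverseˡ π)) (trans (cong (π ⟨$⟩ˡ_) (toℕ-injective (ℕₚ.suc-injective eq))) (inverseˡ π))

  LRMax-dominates : ∀ {k m} → LRMax π k → xc m ≤ xc k → yc π m ≤ yc π k
  LRMax-dominates {k} {m} max m≤k with ℕₚ.m≤n⇒m<n∨m≡n m≤k
  ... | inj₁ m<k = ℕₚ.≮⇒≥ (max m m<k)
  ... | inj₂ m≡k = ℕₚ.≤-reflexive (cong (yc π) (xc-injective m≡k))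

  position-0-LRMax : ∀ {i} → toℕ i ≡ 0 → LRMax π i
  position-0-LRMax {i} i≡0 m m<i = contradiction (subst (xc m <_) (cong suc i≡0) m<i) λ { (s≤s ()) }

  LRMax⇒¬DescentTop-pred : ∀ {i i′} → LRMax π i → xc i ≡ suc (xc i′) → ¬ DescentTop π i′
  LRMax⇒¬DescentTop-pred {i} {i′} max i≡i′+1 (k , k≡i′+1 , k<i′) =
    max i′ (ℕₚ.≤-reflexive (sym i≡i′+1))
      (subst (λ k → yc π k < yc π i′) (xc-injective (trans k≡i′+1 (sym i≡i′+1))) k<i′)

  ¬DescentTop-pred⇒LRMax : Avoids312 π → ∀ {i i′} → xc i ≡ suc (xc i′) → ¬ DescentTop π i′ → LRMax π i
  ¬DescentTop-pred⇒LRMax avoids {i} {i′} i≡i′+1 notTop m m<i i<m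
    with ℕₚ.m≤n⇒m<n∨m≡n (ℕₚ.≤-pred (subst (xc m <_) i≡i′+1 m<i))
  ... | inj₂ m≡i′ = notTop (i , i≡i′+1 , subst (λ m → yc π i < yc π m) (xc-injective m≡i′) i<m)
  ... | inj₁ m<i′ = avoids (m , i′ , i , m<i′ , ℕₚ.≤-reflexive (sym i≡i′+1) , i′<i , i<m)
    where
    i′<i : yc π i′ < yc π i
    i′<i = ℕₚ.≤∧≢⇒< (ℕₚ.≮⇒≥ (λ i<i′ → notTop (i , i≡i′+1 , i<i′)))
                     (λ e → ℕₚ.1+n≢n (trans (sym i≡i′+1) (cong xc (yc-injective (sym e)))))

-- Hooks of a valid hook configuration

ι≡mkℚ : ∀ k → ι k ≡ mkℚ (ℤ.+ k) 0 (Coprimality.sym (Coprimality.1-coprimeTo k))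
ι≡mkℚ k = ℚₚ.normalize-coprime (Coprimality.sym (Coprimality.1-coprimeTo k))

ι-mono-≤ : ∀ {m k} → m ≤ k → ι m ℚ.≤ ι k
ι-mono-≤ {m} {k} m≤k rewrite ι≡mkℚ m | ι≡mkℚ k =
  ℚ.*≤* (subst₂ ℤ._≤_ (sym (ℤₚ.*-identityʳ (ℤ.+ m))) (sym (ℤₚ.*-identityʳ (ℤ.+ k))) (ℤ.+≤+ m≤k))

ι-injective : ∀ {m k} → ι m ≡ ι k → m ≡ k
ι-injective {m} {k} eq = ℤₚ.+-injective (cong ℚ.↥_ (trans (sym (ι≡mkℚ m)) (trans eq (ι≡mkℚ k))))

module Hooks {n} {π : Permutation′ n} {h : Fin n → Maybe (Fin n)} (vhc : IsVHC π h) where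
  open IsVHC vhc

  vertical-on-hook : ∀ {a b q} → yc π a ≤ q → q ≤ yc π b → OnHook π a b (ι (xc a) , ι q)
  vertical-on-hook a≤q q≤b = inj₁ (refl , ι-mono-≤ a≤q , ι-mono-≤ q≤b)

  horizontal-on-hook : ∀ {a b p} → xc a ≤ p → p ≤ xc b → OnHook π a b (ι p , ι (yc π b))
  horizontal-on-hook a≤p p≤b = inj₂ (refl , ι-mono-≤ a≤p , ι-mono-≤ p≤b)

  common-point-inside-absurd : ∀ {a b c d p q} → h a ≡ just b → h c ≡ just d → a ≢ c →
    OnHook π a b (ι p , q) → OnHook π c d (ι p , q) → xc a < p → p < xc b → ⊥
  common-point-inside-absurd {a} {b} {c} {d} ha hc a≢c on₁ on₂ a<p p<b
    with proj₁ (meet-endpoints a b c d ha hc a≢c _ on₁ on₂)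
  ... | inj₁ e = ℕₚ.<-irrefl (sym (ι-injective (cong proj₁ e))) a<p
  ... | inj₂ e = ℕₚ.<-irrefl (ι-injective (cong proj₁ e)) p<b

  private
    <⇒≢ : ∀ {i j : Fin n} → xc i < xc j → i ≢ j
    <⇒≢ i<j refl = ℕₚ.<-irrefl refl i<j

  hook-injective-< : ∀ {c c′ d} → h c ≡ just d → h c′ ≡ just d → xc c < xc c′ → ⊥
  hook-injective-< {c} {c′} {d} hc hc′ c<c′ =
    common-point-inside-absurd hc hc′ (<⇒≢ c<c′)
      (horizontal-on-hook (ℕₚ.<⇒≤ c<c′) (ℕₚ.<⇒≤ (hook-x c′ d hc′)))
      (vertical-on-hook (ℕₚ.<⇒≤ (hook-y c′ d hc′)) ℕₚ.≤-refl)
      c<c′ (hook-x c′ d hc′)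

  hook-injective : ∀ {c c′ d} → h c ≡ just d → h c′ ≡ just d → c ≡ c′
  hook-injective {c} {c′} hc hc′ with ℕₚ.<-cmp (xc c) (xc c′)
  ... | tri< c<c′ _ _ = ⊥-elim (hook-injective-< hc hc′ c<c′)
  ... | tri≈ _ c≡c′ _ = xc-injective π c≡c′
  ... | tri> _ _ c′<c = ⊥-elim (hook-injective-< hc′ hc c′<c)

  hook-end-LRMax : Avoids312 π → ∀ {c z} → h c ≡ just z → LRMax π z
  hook-end-LRMax avoids {c} {z} hc m m<z z<m with ℕₚ.<-cmp (xc m) (xc c)
  ... | tri< m<c _ _ = avoids (m , c , z , m<c , hook-x c z hc , hook-y c z hc , z<m)
  ... | tri≈ _ m≡c _ = ℕₚ.<-asym z<m (subst (λ m → yc π m < yc π z) (sym (xc-injective π m≡c)) (hook-y c z hc))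
  ... | tri> _ _ c<m = hook-valid c z hc m c<m m<z z<m

  hook-end-bound : ∀ {a b c d} → h a ≡ just b → h c ≡ just d → xc a ≤ xc c → xc c < xc b → xc d ≤ xc b
  hook-end-bound {a} {b} {c} {d} ha hc a≤c c<b with ℕₚ.m≤n⇒m<n∨m≡n a≤c
  ... | inj₂ a≡c = ℕₚ.≤-reflexive (cong xc (just-injective (trans (sym hc) (trans (cong h (sym (xc-injective π a≡c))) ha))))
  ... | inj₁ a<c = ℕₚ.≮⇒≥ λ b<d →
    common-point-inside-absurd ha hc (<⇒≢ a<c)
      (horizontal-on-hook (ℕₚ.<⇒≤ a<c) (ℕₚ.<⇒≤ c<b))
      (vertical-on-hook (ℕₚ.≮⇒≥ (hook-valid a b ha c a<c c<b)) (ℕₚ.≮⇒≥ (hook-valid c d hc b c<b b<d)))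
      a<c c<b

  hook-start-bound : Avoids312 π → ∀ {a b c z} → h a ≡ just b → h c ≡ just z → xc a < xc z → xc z ≤ xc b → xc a ≤ xc c
  hook-start-bound avoids {a} {b} {c} {z} ha hc a<z z≤b = ℕₚ.≮⇒≥ λ c<a →
    common-point-inside-absurd hc ha (<⇒≢ c<a)
      (horizontal-on-hook (ℕₚ.<⇒≤ c<a) (ℕₚ.<⇒≤ a<z))
      (vertical-on-hook (LRMax-dominates π (hook-end-LRMax avoids hc) (ℕₚ.<⇒≤ a<z))
                        (LRMax-dominates π (hook-end-LRMax avoids ha) z≤b))
      c<a a<z

-- The letters of P

endsAt : ℕ → Maybe ℕ → ℕ
endsAt z (just d) = indicator (d ℕ.≟ z)
endsAt z nothing = 0

endsAfter : ℕ → Maybe ℕ → ℕ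
endsAfter z (just d) = indicator (z <? d)
endsAfter z nothing = 0

endsAfter-suc : ∀ z m → endsAfter z m ≡ endsAfter (suc z) m + endsAt (suc z) m
endsAfter-suc z nothing = refl
endsAfter-suc z (just d) with ℕₚ.<-cmp (suc z) d
... | tri< z+1<d _ _ = trans (indicator-yes (z <? d) (ℕₚ.<-trans (ℕₚ.n<1+n z) z+1<d))
  (sym (cong₂ _+_ (indicator-yes (suc z <? d) z+1<d) (indicator-no (d ℕ.≟ suc z) (ℕₚ.>⇒≢ z+1<d))))
... | tri≈ _ refl _ = trans (indicator-yes (z <? suc z) ℕₚ.≤-refl)
  (sym (cong₂ _+_ (indicator-no (suc z <? suc z) (ℕₚ.<-irrefl refl)) (indicator-yes (suc z ℕ.≟ suc z) refl)))
... | tri> _ _ d<z+1 = trans (indicator-no (z <? d) (ℕₚ.≤⇒≯ (ℕₚ.≤-pred d<z+1)))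
  (sym (cong₂ _+_ (indicator-no (suc z <? d) (ℕₚ.<-asym d<z+1)) (indicator-no (d ℕ.≟ suc z) (ℕₚ.<⇒≢ d<z+1))))

module Reading {n} {π : Permutation′ n} {h : Fin n → Maybe (Fin n)} (avoids : Avoids312 π) (vhc : IsVHC π h) where
  open IsVHC vhc
  open Hooks vhc

  hookEnd : ℕ → Maybe ℕ
  hookEnd = extend nothing (Maybe.map toℕ ∘ h)

  hookEnd-toℕ : ∀ c → hookEnd (toℕ c) ≡ Maybe.map toℕ (h c)
  hookEnd-toℕ = extend-toℕ nothing (Maybe.map toℕ ∘ h)

  hookEnd-increasing : ∀ {c d} → hookEnd c ≡ just d → c < d
  hookEnd-increasing {c} end with c <? n
  ... | no _ = contradiction end λ ()
  ... | yes c<n with h (fromℕ< c<n) in hc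
  ...   | just e = subst₂ _<_ (toℕ-fromℕ< c<n) (just-injective end) (ℕₚ.≤-pred (hook-x _ e hc))
  ...   | nothing = contradiction end λ ()

  vertexLetter : Fin n → Step
  vertexLetter i with InV? h i
  ... | yes _ = U
  ... | no _ = E

  letterAfter : Maybe ℕ → Step → Step
  letterAfter (just _) _ = D
  letterAfter nothing s = s

  -- Positions are 0-based; position 0 holds the last left-to-right maximum and is never read.
  letter : ℕ → Step
  letter zero = E
  letter (suc x) = letterAfter (hookEnd x) (extend E vertexLetter (suc x))

  letter-hook-start : ∀ {i i′ : Fin n} {d} → toℕ i ≡ suc (toℕ i′) → h i′ ≡ just d → letter (toℕ i) ≡ D
  letter-hook-start {i} {i′} i≡i′+1 hi′ rewrite i≡i′+1 | hookEnd-toℕ i′ | hi′ = refl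

  letter-no-hook-start : ∀ {i i′ : Fin n} → toℕ i ≡ suc (toℕ i′) → h i′ ≡ nothing → letter (toℕ i) ≡ vertexLetter i
  letter-no-hook-start {i} {i′} i≡i′+1 hi′ rewrite i≡i′+1 | hookEnd-toℕ i′ | hi′ =
    trans (cong (extend E vertexLetter) (sym i≡i′+1)) (extend-toℕ E vertexLetter i)

  no-hook-start⇒¬DescentTop : ∀ {i} → h i ≡ nothing → ¬ DescentTop π i
  no-hook-start⇒¬DescentTop {i} hi top with Equivalence.from (sw-descent i) top
  ... | _ , hi′ = contradiction (trans (sym hi) hi′) λ ()

  LRMax⇒no-hook-start-pred : ∀ {i i′} → LRMax π i → xc i ≡ suc (xc i′) → h i′ ≡ nothing
  LRMax⇒no-hook-start-pred {i} {i′} max i≡i′+1 with h i′ in hi′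
  ... | nothing = refl
  ... | just d = contradiction (Equivalence.to (sw-descent i′) (d , hi′)) (LRMax⇒¬DescentTop-pred π max i≡i′+1)

  letter-LRMax : ∀ {i : Fin n} → LRMax π i → 0 < toℕ i → letter (toℕ i) ≡ vertexLetter i
  letter-LRMax {i} max i>0 with predecessor i i>0
  ... | i′ , i≡i′+1 = letter-no-hook-start i≡i′+1 (LRMax⇒no-hook-start-pred max (cong suc i≡i′+1))

  countU-vertexLetter : ∀ i → countU [ vertexLetter i ] ≡ indicator (InV? h i)
  countU-vertexLetter i with InV? h i
  ... | yes _ = refl
  ... | no _ = refl

  countU-letter : ∀ {i : Fin n} → 0 < toℕ i → countU [ letter (toℕ i) ] ≡ indicator (InV? h i)
  countU-letter {i} i>0 with predecessor i i>0
  ... | i′ , i≡i′+1 with h i′ in hi′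
  ...   | nothing = trans (cong (λ s → countU [ s ]) (letter-no-hook-start {i} i≡i′+1 hi′)) (countU-vertexLetter i)
  ...   | just d = trans (cong (λ s → countU [ s ]) (letter-hook-start {i} i≡i′+1 hi′))
    (sym (indicator-no (InV? h i) λ (c , hc) →
      contradiction (trans (sym hi′) (LRMax⇒no-hook-start-pred (hook-end-LRMax avoids hc) (cong suc i≡i′+1))) λ ()))

  countD-vertexLetter : ∀ x → countD [ extend E vertexLetter x ] ≡ 0
  countD-vertexLetter x with x <? n
  ... | no _ = refl
  ... | yes x<n with InV? h (fromℕ< x<n)
  ...   | yes _ = refl
  ...   | no _ = refl

  countD-letter-suc : ∀ c → countD [ letter (suc c) ] ≡ endsAfter (suc c) (hookEnd c) + endsAt (suc c) (hookEnd c)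
  countD-letter-suc c with hookEnd c in end
  ... | nothing = countD-vertexLetter (suc c)
  ... | just d = trans (sym (indicator-yes (c <? d) (hookEnd-increasing end))) (endsAfter-suc c (just d))

  endsAt-hook : ∀ {c z} → h c ≡ just z → endsAt (toℕ z) (hookEnd (toℕ c)) ≡ 1
  endsAt-hook {c} {z} hc rewrite hookEnd-toℕ c | hc = indicator-yes (toℕ z ℕ.≟ toℕ z) refl

  endsAt-no-hook : ∀ {c z} → h c ≢ just z → endsAt (toℕ z) (hookEnd (toℕ c)) ≡ 0
  endsAt-no-hook {c} {z} ¬hc rewrite hookEnd-toℕ c with h c
  ... | nothing = refl
  ... | just d = indicator-no (toℕ d ℕ.≟ toℕ z) λ d≡z → ¬hc (cong just (toℕ-injective d≡z))

  module Excursion {a b : Fin n} (hab : h a ≡ just b) where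

    A B : ℕ
    A = toℕ a
    B = toℕ b

    A<B : A < B
    A<B = ℕₚ.≤-pred (hook-x a b hab)

    crossing : ℕ → ℕ
    crossing z = sumFrom (endsAfter z ∘ hookEnd) A (z ∸ A)

    crossing-A : crossing A ≡ 0
    crossing-A rewrite ℕₚ.n∸n≡0 A = refl

    crossing-B : crossing B ≡ 0
    crossing-B = sumFrom-zero (endsAfter B ∘ hookEnd) A (B ∸ A) λ k k<B∸A →
      let A+k<B = m<o∸n⇒n+m<o (ℕₚ.<⇒≤ A<B) k<B∸A in
      fromFin (λ x → A ≤ x → x < B → endsAfter B (hookEnd x) ≡ 0) nested (A + k) (ℕₚ.<-trans A+k<B (toℕ<n b))
        (ℕₚ.m≤m+n A k) A+k<B
      where
      nested : ∀ c → A ≤ toℕ c → toℕ c < B → endsAfter B (hookEnd (toℕ c)) ≡ 0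
      nested c A≤c c<B rewrite hookEnd-toℕ c with h c in hc
      ... | nothing = refl
      ... | just d = indicator-no (B <? toℕ d) (ℕₚ.≤⇒≯ (ℕₚ.≤-pred (hook-end-bound hab hc (s≤s A≤c) (s≤s c<B))))

    crossing-positive : ∀ {z} → A < z → z < B → 1 ≤ crossing z
    crossing-positive {z} A<z z<B = subst (_≤ crossing z) first-term
      (term≤sumFrom (endsAfter z ∘ hookEnd) A (z ∸ A) 0 (ℕₚ.m<n⇒0<n∸m A<z))
      where
      first-term : endsAfter z (hookEnd (A + 0)) ≡ 1
      first-term rewrite ℕₚ.+-identityʳ A | hookEnd-toℕ a | hab = indicator-yes (z <? B) z<B

    hooks-ending-at : ∀ i → A < toℕ i → toℕ i ≤ B → sumFrom (endsAt (toℕ i) ∘ hookEnd) A (toℕ i ∸ A) ≡ indicator (InV? h i)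
    hooks-ending-at i A<i i≤B with InV? h i
    ... | yes (c , hc) = sumFrom-single f A (toℕ i ∸ A) (toℕ c ∸ A) (ℕₚ.∸-monoˡ-< c<i A≤c) at-c others
      where
      f = endsAt (toℕ i) ∘ hookEnd
      A≤c : A ≤ toℕ c
      A≤c = ℕₚ.≤-pred (hook-start-bound avoids hab hc (s≤s A<i) (s≤s i≤B))
      c<i : toℕ c < toℕ i
      c<i = ℕₚ.≤-pred (hook-x c i hc)
      at-c : f (A + (toℕ c ∸ A)) ≡ 1
      at-c rewrite ℕₚ.m+[n∸m]≡n A≤c = endsAt-hook hc
      others : ∀ k → k < toℕ i ∸ A → k ≢ toℕ c ∸ A → f (A + k) ≡ 0
      others k k<L k≢ = fromFin (λ x → x ≢ toℕ c → f x ≡ 0)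
        (λ c′ c′≢c → endsAt-no-hook λ hc′ → c′≢c (cong toℕ (hook-injective hc′ hc)))
        (A + k) (ℕₚ.<-trans (m<o∸n⇒n+m<o (ℕₚ.<⇒≤ A<i) k<L) (toℕ<n i))
        λ A+k≡c → k≢ (trans (sym (ℕₚ.m+n∸m≡n A k)) (cong (_∸ A) A+k≡c))
    ... | no ¬inV = sumFrom-zero (endsAt (toℕ i) ∘ hookEnd) A (toℕ i ∸ A) λ k k<L →
      fromFin (λ x → endsAt (toℕ i) (hookEnd x) ≡ 0) (λ c → endsAt-no-hook λ hc → ¬inV (c , hc))
        (A + k) (ℕₚ.<-trans (m<o∸n⇒n+m<o (ℕₚ.<⇒≤ A<i) k<L) (toℕ<n i))

    countU-letter-suc : ∀ z → A ≤ z → suc z ≤ B → countU [ letter (suc z) ] ≡ sumFrom (endsAt (suc z) ∘ hookEnd) A (suc z ∸ A)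
    countU-letter-suc z A≤z z<B =
      fromFin (λ x → A < x → x ≤ B → countU [ letter x ] ≡ sumFrom (endsAt x ∘ hookEnd) A (x ∸ A))
        (λ i A<i i≤B → trans (countU-letter (ℕₚ.≤-<-trans z≤n A<i)) (sym (hooks-ending-at i A<i i≤B)))
        (suc z) (ℕₚ.≤-<-trans z<B (toℕ<n b)) (s≤s A≤z) z<B

    balance : ∀ z → A ≤ z → suc z ≤ B → countU [ letter (suc z) ] + crossing (suc z) ≡ countD [ letter (suc z) ] + crossing z
    balance z A≤z z<B = begin
      countU [ letter (suc z) ] + crossing (suc z)
        ≡⟨ cong₂ _+_ (trans (countU-letter-suc z A≤z z<B) (sumFrom-snoc at A z A≤z)) (sumFrom-snoc after A z A≤z) ⟩
      (Y + e) + (X + g)   ≡⟨ rearrange X Y g e ⟩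
      (g + e) + (X + Y)
        ≡⟨ cong₂ _+_ (sym (countD-letter-suc z))
                     (sym (trans (sumFrom-cong (endsAfter z ∘ hookEnd) A (z ∸ A) (λ c _ → endsAfter-suc z (hookEnd (A + c))))
                                 (sumFrom-+ after at A (z ∸ A)))) ⟩
      countD [ letter (suc z) ] + crossing z ∎
      where
      open ≡-Reasoning
      at after : ℕ → ℕ
      at = endsAt (suc z) ∘ hookEnd
      after = endsAfter (suc z) ∘ hookEnd
      X = sumFrom after A (z ∸ A)
      Y = sumFrom at A (z ∸ A)
      g = after z
      e = at z
      rearrange : ∀ X Y g e → (Y + e) + (X + g) ≡ (g + e) + (X + Y)
      rearrange = solve-∀

    height : ℕ → ℕ
    height k = crossing (B ∸ k)

    height-end : height (B ∸ A) ≡ 0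
    height-end = trans (cong crossing (ℕₚ.m∸[m∸n]≡n (ℕₚ.<⇒≤ A<B))) crossing-A

    height-positive : ∀ k → 1 ≤ k → k < B ∸ A → 1 ≤ height k
    height-positive k k>0 k<B∸A = crossing-positive (ℕₚ.m+n≤o⇒m≤o∸n (suc A) (m<o∸n⇒n+m<o (ℕₚ.<⇒≤ A<B) k<B∸A))
      (ℕₚ.∸-monoʳ-< k>0 (ℕₚ.≤-trans (ℕₚ.<⇒≤ k<B∸A) (ℕₚ.m∸n≤m B A)))

    prefix-height : ∀ k → k ≤ B ∸ A → countU (map letter (countdown B k)) ≡ countD (map letter (countdown B k)) + height k
    prefix-height k k≤B∸A = begin
      countU w                   ≡⟨ ℕₚ.+-identityʳ (countU w) ⟨
      countU w + 0               ≡⟨ cong (countU w +_) crossing-B ⟨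
      countU w + crossing B
        ≡⟨ countdown-balance letter crossing A B balance k B (ℕₚ.m≤o∸n⇒m+n≤o k (ℕₚ.<⇒≤ A<B) k≤B∸A) ℕₚ.≤-refl ⟩
      countD w + height k        ∎
      where
      open ≡-Reasoning
      w = map letter (countdown B k)

-- P assembled block by block

module LeftToRightMaxima {n} {π : Permutation′ n} {h : Fin n → Maybe (Fin n)} (avoids : Avoids312 π) (vhc : IsVHC π h)
  {ℓ} (R : Fin (suc ℓ) → Fin n)
  (decreasing : ∀ j j′ → toℕ j < toℕ j′ → toℕ (R j′) < toℕ (R j))
  (isMax : ∀ j → LRMax π (R j))
  (covers : ∀ k → LRMax π k → ∃[ j ] R j ≡ k)
  where
  open Reading avoids vhc

  r : Fin (suc ℓ) → ℕ
  r = toℕ ∘ R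

  r-antitone : Antitone r
  r-antitone j j′ j≤j′ with ℕₚ.m≤n⇒m<n∨m≡n j≤j′
  ... | inj₁ j<j′ = ℕₚ.<⇒≤ (decreasing j j′ j<j′)
  ... | inj₂ j≡j′ = ℕₚ.≤-reflexive (cong r (sym (toℕ-injective j≡j′)))

  r-step : ∀ t → r (Fin.suc t) < r (inject₁ t)
  r-step t = decreasing (inject₁ t) (Fin.suc t) (subst (_< suc (toℕ t)) (sym (toℕ-inject₁ t)) ℕₚ.≤-refl)

  -- The leftmost point is a left-to-right maximum, hence the last one listed.
  r-last : 0 < n → r (fromℕ ℓ) ≡ 0
  r-last n>0 with covers (fromℕ< n>0) (position-0-LRMax π (toℕ-fromℕ< n>0))
  ... | j , Rj≡0 = ℕₚ.n≤0⇒n≡0 (ℕₚ.≤-trans (r-antitone j (fromℕ ℓ) j≤ℓ) (ℕₚ.≤-reflexive (trans (cong toℕ Rj≡0) (toℕ-fromℕ< n>0))))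
    where
    j≤ℓ : toℕ j ≤ toℕ (fromℕ ℓ)
    j≤ℓ = subst (toℕ j ≤_) (sym (toℕ-fromℕ ℓ)) (ℕₚ.≤-pred (toℕ<n j))

  not-strictly-between : ∀ t s → r (Fin.suc t) < r s → r s < r (inject₁ t) → ⊥
  not-strictly-between t s lo<s s<hi with toℕ s ℕ.≤? toℕ t
  ... | yes s≤t = ℕₚ.<⇒≱ s<hi (r-antitone s (inject₁ t) (subst (toℕ s ≤_) (sym (toℕ-inject₁ t)) s≤t))
  ... | no s≰t = ℕₚ.<⇒≱ lo<s (r-antitone (Fin.suc t) s (ℕₚ.≰⇒> s≰t))

  letter-between : ∀ t x → r (Fin.suc t) < x → x < r (inject₁ t) → letter x ≡ D
  letter-between t x lo<x x<hi =
    fromFin (λ x → r (Fin.suc t) < x → x < r (inject₁ t) → letter x ≡ D) at x (ℕₚ.<-trans x<hi (toℕ<n (R (inject₁ t)))) lo<x x<hi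
    where
    at : ∀ i → r (Fin.suc t) < toℕ i → toℕ i < r (inject₁ t) → letter (toℕ i) ≡ D
    at i lo<i i<hi with predecessor i (ℕₚ.≤-<-trans z≤n lo<i)
    ... | i′ , i≡i′+1 with h i′ in hi′
    ...   | just _ = letter-hook-start {i} i≡i′+1 hi′
    ...   | nothing with covers i (¬DescentTop-pred⇒LRMax π avoids (cong suc i≡i′+1) (no-hook-start⇒¬DescentTop hi′))
    ...     | s , Rs≡i rewrite sym Rs≡i = ⊥-elim (not-strictly-between t s lo<i i<hi)

  letter-R : ∀ t → letter (r (inject₁ t)) ≡ Xstep h R t
  letter-R t = trans (letter-LRMax (isMax (inject₁ t)) (ℕₚ.≤-<-trans z≤n (r-step t))) vertexLetter≡Xstep
    where
    vertexLetter≡Xstep : vertexLetter (R (inject₁ t)) ≡ Xstep h R t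
    vertexLetter≡Xstep with InV? h (R (inject₁ t))
    ... | yes _ = refl
    ... | no _ = refl

  γ≡ : ∀ t → γ R t ≡ r (inject₁ t) ∸ suc (r (Fin.suc t))
  γ≡ t = trans (length-filter-allFin (λ x → (suc lo ℕ.<? suc x) ×-dec (suc x ℕ.<? suc hi)) n)
               (sumFrom-interval _ n (λ x (lo<x , x<hi) → ℕₚ.≤-pred lo<x , ℕₚ.≤-pred x<hi)
                                     (λ x lo<x x<hi → s≤s lo<x , s≤s x<hi)
                                     (r-step t) (ℕₚ.<⇒≤ (toℕ<n (R (inject₁ t)))))
    where
    lo = r (Fin.suc t)
    hi = r (inject₁ t)

  block-countdown : ∀ t → block h R t ≡ map letter (countdown (r (inject₁ t)) (gap r t))
  block-countdown t = begin
    Xstep h R t ∷ replicate (γ R t) D                     ≡⟨ cong₂ _∷_ (sym (letter-R t)) (cong (λ k → replicate k D) (γ≡ t)) ⟩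
    letter hi ∷ replicate K D                             ≡⟨ cong (letter hi ∷_) (map-countdown-constant letter D (hi ∸ 1) K inner) ⟨
    map letter (countdown hi (suc K))                     ≡⟨ cong (map letter ∘ countdown hi) (ℕₚ.+-∸-assoc 1 (r-step t)) ⟨
    map letter (countdown hi (gap r t))                   ∎
    where
    open ≡-Reasoning
    lo = r (Fin.suc t)
    hi = r (inject₁ t)
    K = hi ∸ suc lo
    inner : ∀ i → i < K → letter (hi ∸ 1 ∸ i) ≡ D
    inner i i<K = trans (cong letter (ℕₚ.∸-+-assoc hi 1 i)) (letter-between t (hi ∸ suc i)
      (ℕₚ.m+n≤o⇒m≤o∸n (suc lo) (subst (_≤ hi) (sym (ℕₚ.+-suc (suc lo) i)) (m<o∸n⇒n+m<o (r-step t) i<K)))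
      (ℕₚ.∸-monoʳ-< (s≤s z≤n) (ℕₚ.≤-trans i<K (ℕₚ.m∸n≤m hi (suc lo)))))

  pathP-countdown : 0 < n → pathP h R ≡ map letter (countdown (r Fin.zero) (r Fin.zero))
  pathP-countdown n>0 = begin
    concat (map (block h R) (allFin ℓ))                     ≡⟨ cong concat (Listₚ.map-cong block-countdown (allFin ℓ)) ⟩
    concat (map (map letter ∘ piece) (allFin ℓ))            ≡⟨ cong concat (Listₚ.map-∘ (allFin ℓ)) ⟩
    concat (map (map letter) (map piece (allFin ℓ)))        ≡⟨ Listₚ.concat-map (map piece (allFin ℓ)) ⟩
    map letter (concat (map piece (allFin ℓ)))              ≡⟨ cong (map letter) (concat-countdown-gaps ℓ r r-antitone) ⟩
    map letter (countdown (r Fin.zero) (r Fin.zero ∸ r (fromℕ ℓ)))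
      ≡⟨ cong (λ k → map letter (countdown (r Fin.zero) (r Fin.zero ∸ k))) (r-last n>0) ⟩
    map letter (countdown (r Fin.zero) (r Fin.zero))        ∎
    where
    open ≡-Reasoning
    piece : Fin ℓ → List ℕ
    piece t = countdown (r (inject₁ t)) (gap r t)

  posX-gaps : ∀ j → posX h R j ≡ r Fin.zero ∸ r (inject₁ j)
  posX-gaps j = begin
    sum (map (length ∘ block h R) (take (toℕ j) (allFin ℓ)))
      ≡⟨ cong sum (Listₚ.map-cong length-block (take (toℕ j) (allFin ℓ))) ⟩
    sum (map (gap r) (take (toℕ j) (allFin ℓ)))               ≡⟨ cong sum (Listₚ.take-map (toℕ j) (allFin ℓ)) ⟨
    sum (take (toℕ j) (map (gap r) (allFin ℓ)))               ≡⟨ sum-gaps ℓ r r-antitone j ⟩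
    r Fin.zero ∸ r (inject₁ j)                                ∎
    where
    open ≡-Reasoning
    length-block : ∀ t → length (block h R t) ≡ gap r t
    length-block t = trans (cong length (block-countdown t))
      (trans (Listₚ.length-map letter (countdown (r (inject₁ t)) (gap r t))) (length-countdown (r (inject₁ t)) (gap r t)))

  posX+R≡length : 0 < n → ∀ j → posX h R j + r (inject₁ j) ≡ length (pathP h R)
  posX+R≡length n>0 j = begin
    posX h R j + r (inject₁ j)                                ≡⟨ cong (_+ r (inject₁ j)) (posX-gaps j) ⟩
    r Fin.zero ∸ r (inject₁ j) + r (inject₁ j)                ≡⟨ ℕₚ.m∸n+n≡m (r-antitone Fin.zero (inject₁ j) z≤n) ⟩
    r Fin.zero                                                ≡⟨ length-countdown (r Fin.zero) (r Fin.zero) ⟨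
    length (countdown (r Fin.zero) (r Fin.zero))              ≡⟨ Listₚ.length-map letter (countdown (r Fin.zero) (r Fin.zero)) ⟨
    length (map letter (countdown (r Fin.zero) (r Fin.zero))) ≡⟨ cong length (pathP-countdown n>0) ⟨
    length (pathP h R)                                        ∎
    where open ≡-Reasoning

  read-from-X : 0 < n → ∀ j k → k ≤ r (inject₁ j) →
    take k (drop (posX h R j) (pathP h R)) ≡ map letter (countdown (r (inject₁ j)) k)
  read-from-X n>0 j k k≤Rj = begin
    take k (drop (posX h R j) (pathP h R))                     ≡⟨ cong₂ (λ s P → take k (drop s P)) (posX-gaps j) (pathP-countdown n>0) ⟩
    take k (drop (r₀ ∸ rⱼ) (map letter (countdown r₀ r₀)))     ≡⟨ cong (take k) (Listₚ.drop-map (r₀ ∸ rⱼ) (countdown r₀ r₀)) ⟩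
    take k (map letter (drop (r₀ ∸ rⱼ) (countdown r₀ r₀)))     ≡⟨ Listₚ.take-map k (drop (r₀ ∸ rⱼ) (countdown r₀ r₀)) ⟩
    map letter (take k (drop (r₀ ∸ rⱼ) (countdown r₀ r₀)))     ≡⟨ cong (map letter) (take-drop-countdown (r-antitone Fin.zero (inject₁ j) z≤n) k≤Rj) ⟩
    map letter (countdown rⱼ k)                                ∎
    where
    open ≡-Reasoning
    r₀ = r Fin.zero
    rⱼ = r (inject₁ j)

proposition7p3 : (n : ℕ) (π : Permutation′ n) (h : Fin n → Maybe (Fin n)) →
    Avoids312 π → IsVHC π h →
    (ℓ : ℕ) (R : Fin (suc ℓ) → Fin n) →
    (∀ j j′ → toℕ j < toℕ j′ → toℕ (R j′) < toℕ (R j)) →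
    (∀ j → LRMax π (R j)) →
    (∀ k → LRMax π k → ∃[ j ] R j ≡ k) →
    (j : Fin ℓ) (a : Fin n) → h a ≡ just (R (inject₁ j)) →
    LngIs h R j (toℕ (R (inject₁ j)) ∸ toℕ a)
proposition7p3 n π h avoids vhc ℓ R decreasing isMax covers j a hook =
  ℕₚ.m<n⇒0<n∸m A<B , fits , shortest-Motzkin-prefix (drop s P) (B ∸ A) height heights height-end height-positive
  where
  open Reading avoids vhc
  open Excursion hook
  open LeftToRightMaxima avoids vhc R decreasing isMax covers
  P = pathP h R
  s = posX h R j
  n>0 : 0 < n
  n>0 = ℕₚ.≤-<-trans z≤n (toℕ<n a)
  heights : ∀ k → k ≤ B ∸ A → countU (take k (drop s P)) ≡ countD (take k (drop s P)) + height k
  heights k k≤B∸A rewrite read-from-X n>0 j k (ℕₚ.≤-trans k≤B∸A (ℕₚ.m∸n≤m B A)) = prefix-height k k≤B∸A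
  fits : s + (B ∸ A) ≤ length P
  fits = subst (s + (B ∸ A) ≤_) (posX+R≡length n>0 j) (ℕₚ.+-monoʳ-≤ s (ℕₚ.m∸n≤m B A))
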